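{- Let $\mathrm{d}$ be a Dyck path with $\|\mathrm{d}\|\ge1$, and let $\ell$, $v_j$, $\mathrm{d}^{\mathrm{spn}}_j$, $\mathrm{d}^{\mathrm{fix}}$, $\mathrm{d}^{\mathrm{free}}$ be as in the context. Then for all $j\in\{1,\dots,\ell\}$, $\|\mathrm{d}^{\mathrm{spn}}_j\|\le(\|\mathrm{d}\|-v_j)/2$; moreover $\|\mathrm{d}^{\mathrm{fix}}\|=\lceil\|\mathrm{d}\|/2\rceil-1=\lfloor(\|\mathrm{d}\|-1)/2\rfloor$ and $\lfloor\|\mathrm{d}\|/2\rfloor\le\|\mathrm{d}^{\mathrm{free}}\|\le\|\mathrm{d}\|-1$.
   Context: Write $[\![j,k]\!]=\{j,\dots,k\}$. A Dyck path of length $2n$ is a function $\mathrm{d}:[\![0,2n]\!]\to\mathbb{Z}_{\ge0}$ with $\mathrm{d}(0)=\mathrm{d}(2n)=0$ and $|\mathrm{d}(i)-\mathrm{d}(i-1)|=1$ for $i\in[\![1,2n]\!]$; its height is $\|\mathrm{d}\|=\max_i\mathrm{d}(i)$. Decomposition: let $\mathrm{d}$ have length $2n$ and height $h\ge1$, and $m=\lfloor h/2\rfloor$. Set $\sigma_{\max}=\min\{i:\mathrm{d}(i)=h\}$, $\sigma_g=\max\{i\in[\![0,\sigma_{\max}]\!]:\mathrm{d}(i)=m\}$, $\sigma_d=\min\{i\in[\![\sigma_{\max},2n]\!]:\mathrm{d}(i)=m\}$, $\sigma_{\mathrm{last}}=\max\{i\in[\![\sigma_{\max},2n]\!]:\mathrm{d}(i)=m\}$.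 List $\{i\in[\![\sigma_d,\sigma_{\mathrm{last}}]\!]:\mathrm{d}(i)=m\}$ increasingly as $\sigma_d=\rho_1<\dots<\rho_\ell<\rho_{\ell+1}=\sigma_{\mathrm{last}}$ (so $\ell\ge0$). Define the Dyck paths $\mathrm{d}^{\mathrm{fix}}(i)=\mathrm{d}(\sigma_g+1+i)-m-1$ for $i\in[\![0,\sigma_d-\sigma_g-2]\!]$; $\mathrm{d}^{\mathrm{free}}(i)=\mathrm{d}(i)$ for $i\in[\![0,\sigma_g]\!]$ and $\mathrm{d}^{\mathrm{free}}(i)=\mathrm{d}(\sigma_{\mathrm{last}}+i-\sigma_g)$ for $i\in[\![\sigma_g+1,2n-(\sigma_{\mathrm{last}}-\sigma_g)]\!]$; and for $j\in[\![1,\ell]\!]$, $\mathrm{d}^{\mathrm{spn}}_j(i)=|\mathrm{d}(\rho_j+1+i)-m|-1$ for $i\in[\![0,\rho_{j+1}-\rho_j-2]\!]$. Let $\epsilon_j=\mathrm{d}(\rho_j+1)-\mathrm{d}(\rho_j)\in\{ -1,1\}$, $u_j=(3+\epsilon_j)/2$ and $v_j=(3-\epsilon_j)/2$. -}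

module Defs where

open import Data.Bool using (Bool; true; false; if_then_else_)
open import Data.Nat
open import Data.List using (List; []; _∷_; length)
open import Data.Sum using (_⊎_)
open import Relation.Binary.PropositionalEquality using (_≡_)

-- A path is a function ℕ → ℕ; only its values on [0, len] matter.
-- A Dyck path of length 2n: d 0 = d (2n) = 0 and |d i - d (i-1)| = 1 on [1,2n].
IsDyck : ℕ → (ℕ → ℕ) → Set
IsDyck n d =
  (d 0 ≡ 0) ×' (d (2 * n) ≡ 0) ×'
  (∀ i → 1 ≤ i → i ≤ 2 * n → (d i ≡ suc (d (i ∸ 1))) ⊎ (d (i ∸ 1) ≡ suc (d i)))
  where
  open import Data.Product renaming (_×_ to _×'_)

height : ℕ → (ℕ → ℕ) → ℕ
height zero d = d 0
height (suc k) d = height k d ⊔ d (suc k)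

firstFrom : (ℕ → Bool) → ℕ → ℕ → ℕ
firstFrom p i zero = i
firstFrom p i (suc k) = if p i then i else firstFrom p (suc i) k

lastDown : (ℕ → Bool) → ℕ → ℕ → ℕ
lastDown p i zero = i
lastDown p i (suc k) = if p i then i else lastDown p (i ∸ 1) k

minIn : (ℕ → Bool) → ℕ → ℕ → ℕ
minIn p lo hi = firstFrom p lo (hi ∸ lo)

maxIn : (ℕ → Bool) → ℕ → ℕ → ℕ
maxIn p lo hi = lastDown p hi (hi ∸ lo)

hitsFrom : (ℕ → Bool) → ℕ → ℕ → List ℕ
hitsFrom p i zero = if p i then i ∷ [] else []
hitsFrom p i (suc k) = if p i then i ∷ hitsFrom p (suc i) k else hitsFrom p (suc i) k

at : List ℕ → ℕ → ℕ
at [] _ = 0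
at (x ∷ xs) zero = x
at (x ∷ xs) (suc j) = at xs j

module Decomp (n : ℕ) (d : ℕ → ℕ) where
  L : ℕ
  L = 2 * n

  h : ℕ
  h = height L d

  m : ℕ
  m = ⌊ h /2⌋

  σmax : ℕ
  σmax = minIn (λ i → d i ≡ᵇ h) 0 L

  σg : ℕ
  σg = maxIn (λ i → d i ≡ᵇ m) 0 σmax

  σd : ℕ
  σd = minIn (λ i → d i ≡ᵇ m) σmax L

  σlast : ℕ
  σlast = maxIn (λ i → d i ≡ᵇ m) σmax L

  -- ρ_1 < … < ρ_{ℓ+1} : the i ∈ [σd, σlast] with d i = m
  rhos : List ℕ
  rhos = hitsFrom (λ i → d i ≡ᵇ m) σd (σlast ∸ σd)

  ℓ : ℕ
  ℓ = length rhos ∸ 1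

  -- ρ j for j ≥ 1 (1-indexed)
  ρ : ℕ → ℕ
  ρ j = at rhos (j ∸ 1)

  Lfix : ℕ
  Lfix = σd ∸ σg ∸ 2

  dfix : ℕ → ℕ
  dfix i = d (σg + 1 + i) ∸ m ∸ 1

  Lfree : ℕ
  Lfree = L ∸ (σlast ∸ σg)

  dfree : ℕ → ℕ
  dfree i = if i ≤ᵇ σg then d i else d (σlast + (i ∸ σg))

  Lspn : ℕ → ℕ
  Lspn j = ρ (suc j) ∸ ρ j ∸ 2

  dspn : ℕ → ℕ → ℕ
  dspn j i = ∣ d (ρ j + 1 + i) - m ∣ ∸ 1

  -- ε_j = d(ρ_j+1) - d(ρ_j) ∈ {-1,1};  v_j = (3 - ε_j)/2, i.e. 1 if ε_j = 1, 2 if ε_j = -1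
  v : ℕ → ℕ
  v j = if d (ρ j) <ᵇ d (ρ j + 1) then 1 else 2

-- Everything is controlled by the visits of d to level m = ⌊h/2⌋: a path moving by ±1 cannot cross
-- a level without visiting it. d^fix is the stretch strictly between the visits σg < σmax < σd around
-- the first maximum, so it contains d σmax = h and has height h − m − 1 = ⌈h/2⌉ − 1. d^free keeps the
-- part before σg, where d < h because σmax is the first maximum, and the part after σlast, where d < m
-- because d never returns to m. Each d^spn_j is an excursion between consecutive visits to m, hence
-- strictly on one side of m: above it, |d − m| − 1 ≤ h − m − 1; below it, |d − m| − 1 ≤ m − 1 with
-- m ≥ 1. These two cases are exactly v_j = 1 and v_j = 2.

module Submission where

open import Defs
open import Data.Bool using (Bool; true; false; if_then_else_; T)
open import Data.List using (length)
open import Data.Nat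
open import Data.Nat.Properties
open import Data.Product using (_×_; _,_; ∃-syntax; proj₁; proj₂)
open import Data.Sum using (_⊎_; inj₁; inj₂)
open import Function using (_∘_)
open import Relation.Nullary using (¬_; yes; no; contradiction)
open import Relation.Binary.PropositionalEquality

≤-height : ∀ k (f : ℕ → ℕ) {i} → i ≤ k → f i ≤ height k f
≤-height zero    f z≤n = ≤-refl
≤-height (suc k) f {i} i≤1+k with i ≟ suc k
... | yes refl   = m≤n⊔m (height k f) (f (suc k))
... | no i≢1+k   = ≤-trans (≤-height k f (s≤s⁻¹ (≤∧≢⇒< i≤1+k i≢1+k))) (m≤m⊔n _ _)

height-lub : ∀ k (f : ℕ → ℕ) {b} → (∀ i → i ≤ k → f i ≤ b) → height k f ≤ b
height-lub zero    f bound = bound 0 z≤n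
height-lub (suc k) f bound =
  ⊔-lub (height-lub k f (λ i → bound i ∘ m≤n⇒m≤1+n)) (bound (suc k) ≤-refl)

height-attained : ∀ k (f : ℕ → ℕ) → ∃[ i ] i ≤ k × f i ≡ height k f
height-attained zero    f = 0 , z≤n , refl
height-attained (suc k) f with ≤-total (height k f) (f (suc k))
... | inj₁ hk≤fk = suc k , ≤-refl , sym (m≤n⇒m⊔n≡n hk≤fk)
... | inj₂ fk≤hk with height-attained k f
...   | i , i≤k , fi≡hk = i , m≤n⇒m≤1+n i≤k , trans fi≡hk (sym (m≥n⇒m⊔n≡m fk≤hk))

height-≡ : ∀ k (f : ℕ → ℕ) {b} → (∀ i → i ≤ k → f i ≤ b) →
           ∀ {i} → i ≤ k → f i ≡ b → height k f ≡ b
height-≡ k f bound i≤k fi≡b =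
  ≤-antisym (height-lub k f bound) (subst (_≤ height k f) fi≡b (≤-height k f i≤k))

T-true : ∀ {b} → b ≡ true → T b
T-true refl = _

¬T-false : ∀ {b} → b ≡ false → ¬ T b
¬T-false refl ()

if-≤ᵇ-yes : ∀ {a b} {A : Set} {p q : A} → a ≤ b → (if a ≤ᵇ b then p else q) ≡ p
if-≤ᵇ-yes {a} {b} a≤b with a ≤ᵇ b in a≤ᵇb
... | true  = refl
... | false = contradiction (≤⇒≤ᵇ a≤b) (¬T-false a≤ᵇb)

if-≤ᵇ-no : ∀ {a b} {A : Set} {p q : A} → b < a → (if a ≤ᵇ b then p else q) ≡ q
if-≤ᵇ-no {a} {b} b<a with a ≤ᵇ b in a≤ᵇb
... | true  = contradiction (≤ᵇ⇒≤ a b (T-true a≤ᵇb)) (<⇒≱ b<a)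
... | false = refl

if-<ᵇ-yes : ∀ {a b} {A : Set} {p q : A} → a < b → (if a <ᵇ b then p else q) ≡ p
if-<ᵇ-yes {a} {b} a<b with a <ᵇ b in a<ᵇb
... | true  = refl
... | false = contradiction (<⇒<ᵇ a<b) (¬T-false a<ᵇb)

if-<ᵇ-no : ∀ {a b} {A : Set} {p q : A} → b ≤ a → (if a <ᵇ b then p else q) ≡ q
if-<ᵇ-no {a} {b} b≤a with a <ᵇ b in a<ᵇb
... | true  = contradiction (<ᵇ⇒< a b (T-true a<ᵇb)) (≤⇒≯ b≤a)
... | false = refl

<⇒≤∸1 : ∀ {m n} → m < n → m ≤ n ∸ 1
<⇒≤∸1 (s≤s m≤n) = m≤n

1+m≤n∸1⇒1+m<n : ∀ {m n} → suc m ≤ n ∸ 1 → suc m < n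
1+m≤n∸1⇒1+m<n {n = suc n} 1+m≤n = s≤s 1+m≤n

1≤n⇒⌊n/2⌋<n : ∀ {n} → 1 ≤ n → ⌊ n /2⌋ < n
1≤n⇒⌊n/2⌋<n {suc n} _ = ⌊n/2⌋<n n

n∸⌊n/2⌋≡⌈n/2⌉ : ∀ n → n ∸ ⌊ n /2⌋ ≡ ⌈ n /2⌉
n∸⌊n/2⌋≡⌈n/2⌉ n = trans (cong (_∸ ⌊ n /2⌋) (sym (⌊n/2⌋+⌈n/2⌉≡n n))) (m+n∸m≡n ⌊ n /2⌋ ⌈ n /2⌉)

⌈n/2⌉∸1≡⌊[n∸1]/2⌋ : ∀ n → ⌈ n /2⌉ ∸ 1 ≡ ⌊ (n ∸ 1) /2⌋
⌈n/2⌉∸1≡⌊[n∸1]/2⌋ zero    = refl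
⌈n/2⌉∸1≡⌊[n∸1]/2⌋ (suc n) = refl

2*⌊n/2⌋≤n : ∀ n → 2 * ⌊ n /2⌋ ≤ n
2*⌊n/2⌋≤n zero          = z≤n
2*⌊n/2⌋≤n (suc zero)    = z≤n
2*⌊n/2⌋≤n (suc (suc n)) rewrite *-suc 2 ⌊ n /2⌋ = s≤s (s≤s (2*⌊n/2⌋≤n n))

2*[⌈n/2⌉∸1]+1≤n : ∀ n → 1 ≤ n → 2 * (⌈ n /2⌉ ∸ 1) + 1 ≤ n
2*[⌈n/2⌉∸1]+1≤n (suc n) _ = ≤-trans (≤-reflexive (+-comm _ 1)) (s≤s (2*⌊n/2⌋≤n n))

2*[⌊n/2⌋∸1]+2≤n : ∀ n → 1 ≤ ⌊ n /2⌋ → 2 * (⌊ n /2⌋ ∸ 1) + 2 ≤ n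
2*[⌊n/2⌋∸1]+2≤n (suc (suc n)) _ = ≤-trans (≤-reflexive (+-comm _ 2)) (s≤s (s≤s (2*⌊n/2⌋≤n n)))

interior-index : ∀ {x y i} → suc x < y → i ≤ y ∸ x ∸ 2 → x + 1 + i < y
interior-index {x} {y} {i} 1+x<y i≤ = begin
  suc (x + 1 + i)   ≡⟨ cong suc (+-comm (x + 1) i) ⟩
  suc (i + (x + 1)) ≡⟨ sym (+-suc i (x + 1)) ⟩
  i + suc (x + 1)   ≡⟨ cong (i +_) (sym (+-suc x 1)) ⟩
  i + (x + 2)       ≤⟨ m≤o∸n⇒m+n≤o i x+2≤y (subst (i ≤_) (∸-+-assoc y x 2) i≤) ⟩
  y                 ∎
  where
  open ≤-Reasoning
  x+2≤y : x + 2 ≤ y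
  x+2≤y = subst (_≤ y) (+-comm 2 x) 1+x<y

index-of-interior : ∀ {x y z} → x < z → z < y → ∃[ i ] i ≤ y ∸ x ∸ 2 × x + 1 + i ≡ z
index-of-interior {x} {y} {z} x<z z<y = z ∸ (x + 1) , i≤ , m+[n∸m]≡n x+1≤z
  where
  x+1≤z : x + 1 ≤ z
  x+1≤z = subst (_≤ z) (+-comm 1 x) x<z
  i+[x+2]≡1+z : z ∸ (x + 1) + (x + 2) ≡ suc z
  i+[x+2]≡1+z = begin
    z ∸ (x + 1) + (x + 2)      ≡⟨ cong (z ∸ (x + 1) +_) (+-suc x 1) ⟩
    z ∸ (x + 1) + suc (x + 1)  ≡⟨ +-suc (z ∸ (x + 1)) (x + 1) ⟩
    suc (z ∸ (x + 1) + (x + 1)) ≡⟨ cong suc (m∸n+n≡m x+1≤z) ⟩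
    suc z                      ∎
    where open ≡-Reasoning
  i≤ : z ∸ (x + 1) ≤ y ∸ x ∸ 2
  i≤ = subst (z ∸ (x + 1) ≤_) (sym (∸-+-assoc y x 2))
         (m+n≤o⇒m≤o∸n (z ∸ (x + 1)) (subst (_≤ y) (sym i+[x+2]≡1+z) z<y))

shifted-index : ∀ {a b i L} → a ≤ b → b ≤ L → a < i → i ≤ L ∸ (b ∸ a) →
                b < b + (i ∸ a) × b + (i ∸ a) ≤ L
shifted-index {a} {b} {i} {L} a≤b b≤L a<i i≤ = m<m+n b (m<n⇒0<n∸m a<i) , (begin
  b + (i ∸ a)           ≡⟨ cong (_+ (i ∸ a)) (sym (m∸n+n≡m a≤b)) ⟩
  b ∸ a + a + (i ∸ a)   ≡⟨ +-assoc (b ∸ a) a (i ∸ a) ⟩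
  b ∸ a + (a + (i ∸ a)) ≡⟨ cong (b ∸ a +_) (m+[n∸m]≡n (<⇒≤ a<i)) ⟩
  b ∸ a + i             ≡⟨ +-comm (b ∸ a) i ⟩
  i + (b ∸ a)           ≤⟨ m≤o∸n⇒m+n≤o i (≤-trans (m∸n≤m b a) b≤L) i≤ ⟩
  L                     ∎)
  where open ≤-Reasoning

module Search (p : ℕ → Bool) where

  record IsFirst (lo hi x : ℕ) : Set where
    field
      lo≤x         : lo ≤ x
      x≤hi         : x ≤ hi
      holds        : T (p x)
      fails-before : ∀ {j} → lo ≤ j → j < x → ¬ T (p j)

  record IsLast (lo hi x : ℕ) : Set where
    field
      lo≤x        : lo ≤ x
      x≤hi        : x ≤ hi
      holds       : T (p x)
      fails-after : ∀ {j} → x < j → j ≤ hi → ¬ T (p j)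

  record Gap (x y : ℕ) : Set where
    field
      x<y           : x < y
      holds-x       : T (p x)
      holds-y       : T (p y)
      fails-between : ∀ {z} → x < z → z < y → ¬ T (p z)

  IsFirst-here : ∀ {x hi} → x ≤ hi → T (p x) → IsFirst x hi x
  IsFirst-here x≤hi px = record
    { lo≤x = ≤-refl ; x≤hi = x≤hi ; holds = px
    ; fails-before = λ x≤j j<x → contradiction j<x (≤⇒≯ x≤j) }

  IsFirst-extend : ∀ {lo hi x} → ¬ T (p lo) → IsFirst (suc lo) hi x → IsFirst lo hi x
  IsFirst-extend {lo} ¬plo first = record
    { lo≤x = ≤-trans (n≤1+n lo) lo≤x ; x≤hi = x≤hi ; holds = holds ; fails-before = fails }
    where
    open IsFirst first
    fails : ∀ {j} → lo ≤ j → j < _ → ¬ T (p j)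
    fails lo≤j j<x with m≤n⇒m<n∨m≡n lo≤j
    ... | inj₁ lo<j  = fails-before lo<j j<x
    ... | inj₂ refl = ¬plo

  IsLast-here : ∀ {lo x} → lo ≤ x → T (p x) → IsLast lo x x
  IsLast-here lo≤x px = record
    { lo≤x = lo≤x ; x≤hi = ≤-refl ; holds = px
    ; fails-after = λ x<j j≤x → contradiction j≤x (<⇒≱ x<j) }

  IsLast-extend : ∀ {lo hi x} → ¬ T (p hi) → IsLast lo (hi ∸ 1) x → IsLast lo hi x
  IsLast-extend {hi = hi} ¬phi last = record
    { lo≤x = lo≤x ; x≤hi = ≤-trans x≤hi (m∸n≤m hi 1) ; holds = holds ; fails-after = fails }
    where
    open IsLast last
    fails : ∀ {j} → _ < j → j ≤ hi → ¬ T (p j)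
    fails x<j j≤hi with m≤n⇒m<n∨m≡n j≤hi
    ... | inj₁ j<hi = fails-after x<j (<⇒≤∸1 j<hi)
    ... | inj₂ refl = ¬phi

  firstFrom-isFirst : ∀ k i {w} → i ≤ w → w ≤ i + k → T (p w) →
                      IsFirst i (i + k) (firstFrom p i k)
  firstFrom-isFirst zero i {w} i≤w w≤i+0 pw = IsFirst-here (m≤m+n i 0) (subst (T ∘ p) (sym i≡w) pw)
    where
    i≡w : i ≡ w
    i≡w = ≤-antisym i≤w (subst (w ≤_) (+-identityʳ i) w≤i+0)
  firstFrom-isFirst (suc k) i {w} i≤w w≤ pw with p i in pi
  ... | true  = IsFirst-here (m≤m+n i _) (T-true pi)
  ... | false = IsFirst-extend (¬T-false pi)
                  (subst (λ hi → IsFirst (suc i) hi (firstFrom p (suc i) k)) (sym (+-suc i k))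
                    (firstFrom-isFirst k (suc i) i<w (subst (w ≤_) (+-suc i k) w≤) pw))
    where
    i<w : i < w
    i<w = ≤∧≢⇒< i≤w (λ { refl → ¬T-false pi pw })

  minIn-isFirst : ∀ {lo hi w} → lo ≤ w → w ≤ hi → T (p w) → IsFirst lo hi (minIn p lo hi)
  minIn-isFirst {lo} {hi} lo≤w w≤hi pw =
    subst (λ hi′ → IsFirst lo hi′ (minIn p lo hi)) lo+[hi∸lo]≡hi
      (firstFrom-isFirst (hi ∸ lo) lo lo≤w (subst (_ ≤_) (sym lo+[hi∸lo]≡hi) w≤hi) pw)
    where
    lo+[hi∸lo]≡hi : lo + (hi ∸ lo) ≡ hi
    lo+[hi∸lo]≡hi = m+[n∸m]≡n (≤-trans lo≤w w≤hi)

  lastDown-isLast : ∀ k i {w} → i ∸ k ≤ w → w ≤ i → T (p w) →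
                    IsLast (i ∸ k) i (lastDown p i k)
  lastDown-isLast zero i {w} i≤w w≤i = IsLast-here ≤-refl ∘ subst (T ∘ p) (≤-antisym w≤i i≤w)
  lastDown-isLast (suc k) i {w} lo≤w w≤i pw with p i in pi
  ... | true  = IsLast-here (m∸n≤m i (suc k)) (T-true pi)
  ... | false = IsLast-extend (¬T-false pi)
                  (subst (λ lo → IsLast lo (i ∸ 1) (lastDown p (i ∸ 1) k)) (∸-+-assoc i 1 k)
                    (lastDown-isLast k (i ∸ 1) (subst (_≤ w) (sym (∸-+-assoc i 1 k)) lo≤w)
                      (<⇒≤∸1 w<i) pw))
    where
    w<i : w < i
    w<i = ≤∧≢⇒< w≤i (λ { refl → ¬T-false pi pw })

  maxIn-isLast : ∀ {lo hi w} → lo ≤ w → w ≤ hi → T (p w) → IsLast lo hi (maxIn p lo hi)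
  maxIn-isLast {lo} {hi} lo≤w w≤hi pw =
    subst (λ lo′ → IsLast lo′ hi (maxIn p lo hi)) hi∸[hi∸lo]≡lo
      (lastDown-isLast (hi ∸ lo) hi (subst (_≤ _) (sym hi∸[hi∸lo]≡lo) lo≤w) w≤hi pw)
    where
    hi∸[hi∸lo]≡lo : hi ∸ (hi ∸ lo) ≡ lo
    hi∸[hi∸lo]≡lo = m∸[m∸n]≡n (≤-trans lo≤w w≤hi)

  hitsFrom-head : ∀ k i → 0 < length (hitsFrom p i k) →
                  IsFirst i (i + k) (at (hitsFrom p i k) 0)
  hitsFrom-head zero i nonempty with p i in pi
  ... | true = IsFirst-here (m≤m+n i 0) (T-true pi)
  hitsFrom-head (suc k) i nonempty with p i in pi
  ... | true  = IsFirst-here (m≤m+n i _) (T-true pi)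
  ... | false = IsFirst-extend (¬T-false pi)
                  (subst (λ hi → IsFirst (suc i) hi (at (hitsFrom p (suc i) k) 0)) (sym (+-suc i k))
                    (hitsFrom-head k (suc i) nonempty))

  hitsFrom-≤ : ∀ k i j → j < length (hitsFrom p i k) → at (hitsFrom p i k) j ≤ i + k
  hitsFrom-≤ zero i j j<len with p i
  hitsFrom-≤ zero i zero _ | true = m≤m+n i 0
  hitsFrom-≤ zero i (suc j) (s≤s ()) | true
  hitsFrom-≤ (suc k) i j j<len with p i
  hitsFrom-≤ (suc k) i zero _ | true = m≤m+n i _
  hitsFrom-≤ (suc k) i (suc j) (s≤s j<len) | true =
    subst (at (hitsFrom p (suc i) k) j ≤_) (sym (+-suc i k)) (hitsFrom-≤ k (suc i) j j<len)
  ... | false =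
    subst (at (hitsFrom p (suc i) k) j ≤_) (sym (+-suc i k)) (hitsFrom-≤ k (suc i) j j<len)

  hitsFrom-gap : ∀ k i j → suc j < length (hitsFrom p i k) →
                 Gap (at (hitsFrom p i k) j) (at (hitsFrom p i k) (suc j))
  hitsFrom-gap zero i j 1+j<len with p i
  hitsFrom-gap zero i j (s≤s ()) | true
  hitsFrom-gap (suc k) i j 1+j<len with p i in pi
  hitsFrom-gap (suc k) i zero (s≤s 0<len) | true = record
    { x<y = lo≤x ; holds-x = T-true pi ; holds-y = holds ; fails-between = fails-before }
    where open IsFirst (hitsFrom-head k (suc i) 0<len)
  hitsFrom-gap (suc k) i (suc j) (s≤s 1+j<len) | true = hitsFrom-gap k (suc i) j 1+j<len
  ... | false = hitsFrom-gap k (suc i) j 1+j<len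

UnitSteps : ℕ → (ℕ → ℕ) → Set
UnitSteps L f = ∀ i → suc i ≤ L → f (suc i) ≡ suc (f i) ⊎ f i ≡ suc (f (suc i))

Between : ℕ → ℕ → ℕ → Set
Between c a b = (a ≤ c × c ≤ b) ⊎ (c ≤ a × b ≤ c)

module UnitStepPath {L : ℕ} {f : ℕ → ℕ} (steps : UnitSteps L f) where

  level : ℕ → ℕ → Bool
  level c i = f i ≡ᵇ c

  open Search

  Avoids : ℕ → ℕ → ℕ → Set
  Avoids c a b = ∀ {w} → a ≤ w → w ≤ b → f w ≢ c

  step-≤ : ∀ {a} → suc a ≤ L → f (suc a) ≤ suc (f a) × f a ≤ suc (f (suc a))
  step-≤ {a} 1+a≤L with steps a 1+a≤L
  ... | inj₁ up   = ≤-reflexive up , ≤-trans (n≤1+n (f a)) (≤-trans (≤-reflexive (sym up)) (n≤1+n _))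
  ... | inj₂ down = ≤-trans (n≤1+n _) (≤-trans (≤-reflexive (sym down)) (n≤1+n _)) , ≤-reflexive down

  step-toward : ∀ {a c q} → suc a ≤ L → f a ≢ c → Between c (f a) q → Between c (f (suc a)) q
  step-toward 1+a≤L fa≢c (inj₁ (fa≤c , c≤q)) =
    inj₁ (≤-trans (proj₁ (step-≤ 1+a≤L)) (≤∧≢⇒< fa≤c fa≢c) , c≤q)
  step-toward 1+a≤L fa≢c (inj₂ (c≤fa , q≤c)) =
    inj₂ (s≤s⁻¹ (≤-trans (≤∧≢⇒< c≤fa (fa≢c ∘ sym)) (proj₂ (step-≤ 1+a≤L))) , q≤c)

  ivt-from : ∀ k a {c} → a + k ≤ L → Between c (f a) (f (a + k)) →
             ∃[ z ] a ≤ z × z ≤ a + k × f z ≡ c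
  ivt-from zero a {c} _ btw =
    a , ≤-refl , m≤m+n a 0 , squeeze (subst (Between c (f a) ∘ f) (+-identityʳ a) btw)
    where
    squeeze : Between c (f a) (f a) → f a ≡ c
    squeeze (inj₁ (fa≤c , c≤fa)) = ≤-antisym fa≤c c≤fa
    squeeze (inj₂ (c≤fa , fa≤c)) = ≤-antisym fa≤c c≤fa
  ivt-from (suc k) a {c} a+1+k≤L btw with f a ≟ c
  ... | yes fa≡c = a , ≤-refl , m≤m+n a _ , fa≡c
  ... | no fa≢c with ivt-from k (suc a) (subst (_≤ L) (+-suc a k) a+1+k≤L)
                       (step-toward 1+a≤L fa≢c (subst (Between c (f a) ∘ f) (+-suc a k) btw))
    where
    1+a≤L : suc a ≤ L
    1+a≤L = ≤-trans (s≤s (m≤m+n a k)) (subst (_≤ L) (+-suc a k) a+1+k≤L)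
  ...   | z , 1+a≤z , z≤ , fz≡c =
    z , ≤-trans (n≤1+n a) 1+a≤z , subst (z ≤_) (sym (+-suc a k)) z≤ , fz≡c

  ivt : ∀ {a b c} → a ≤ b → b ≤ L → Between c (f a) (f b) → ∃[ z ] a ≤ z × z ≤ b × f z ≡ c
  ivt {a} {b} {c} a≤b =
    subst (λ b → b ≤ L → Between c (f a) (f b) → ∃[ z ] a ≤ z × z ≤ b × f z ≡ c)
      (m+[n∸m]≡n a≤b) (ivt-from (b ∸ a) a)

  Avoids⇒¬Between : ∀ {a b c} → a ≤ b → b ≤ L → Avoids c a b → ¬ Between c (f a) (f b)
  Avoids⇒¬Between a≤b b≤L avoids btw with ivt a≤b b≤L btw
  ... | z , a≤z , z≤b , fz≡c = avoids a≤z z≤b fz≡c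

  above-persists : ∀ {a b c} → a ≤ b → b ≤ L → Avoids c a b → c < f a → c < f b
  above-persists a≤b b≤L avoids c<fa =
    ≰⇒> λ fb≤c → Avoids⇒¬Between a≤b b≤L avoids (inj₂ (<⇒≤ c<fa , fb≤c))

  below-persists : ∀ {a b c} → a ≤ b → b ≤ L → Avoids c a b → f a < c → f b < c
  below-persists a≤b b≤L avoids fa<c =
    ≰⇒> λ c≤fb → Avoids⇒¬Between a≤b b≤L avoids (inj₁ (<⇒≤ fa<c , c≤fb))

  unit-step-≢ : ∀ {i} → suc i ≤ L → f (suc i) ≢ f i
  unit-step-≢ {i} 1+i≤L with steps i 1+i≤L
  ... | inj₁ up   = λ f[1+i]≡fi → 1+n≢n (trans (sym up) f[1+i]≡fi)
  ... | inj₂ down = λ f[1+i]≡fi → 1+n≢n (trans (sym down) (sym f[1+i]≡fi))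

  StrictlyAbove StrictlyBelow : ℕ → ℕ → ℕ → Set
  StrictlyAbove c x y = ∀ {z} → x < z → z < y → c < f z
  StrictlyBelow c x y = ∀ {z} → x < z → z < y → f z < c

  excursion-side : ∀ {c x y} → y ≤ L → Gap (level c) x y →
                   suc x < y × (StrictlyAbove c x y ⊎ StrictlyBelow c x y)
  excursion-side {c} {x} {y} y≤L gap = 1+x<y , side (steps x 1+x≤L)
    where
    open Gap gap
    1+x≤L : suc x ≤ L
    1+x≤L = ≤-trans x<y y≤L
    fx≡c : f x ≡ c
    fx≡c = ≡ᵇ⇒≡ _ _ holds-x
    1+x<y : suc x < y
    1+x<y = ≤∧≢⇒< x<y λ 1+x≡y →
      unit-step-≢ 1+x≤L (trans (cong f 1+x≡y) (trans (≡ᵇ⇒≡ _ _ holds-y) (sym fx≡c)))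
    avoids : ∀ {z} → z < y → Avoids c (suc x) z
    avoids z<y 1+x≤w w≤z = fails-between 1+x≤w (≤-<-trans w≤z z<y) ∘ ≡⇒≡ᵇ _ _
    side : f (suc x) ≡ suc (f x) ⊎ f x ≡ suc (f (suc x)) → StrictlyAbove c x y ⊎ StrictlyBelow c x y
    side (inj₁ up)   = inj₁ λ x<z z<y → above-persists x<z (≤-trans (<⇒≤ z<y) y≤L) (avoids z<y)
                                          (≤-reflexive (sym (trans up (cong suc fx≡c))))
    side (inj₂ down) = inj₂ λ x<z z<y → below-persists x<z (≤-trans (<⇒≤ z<y) y≤L) (avoids z<y)
                                          (≤-reflexive (trans (sym down) fx≡c))

module DyckDecomposition {n : ℕ} {d : ℕ → ℕ} (dyck : IsDyck n d) (h≥1 : 1 ≤ Decomp.h n d) where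

  open Decomp n d
  open Search

  d[0]≡0 : d 0 ≡ 0
  d[0]≡0 = proj₁ dyck

  d[L]≡0 : d L ≡ 0
  d[L]≡0 = proj₁ (proj₂ dyck)

  steps : UnitSteps L d
  steps i = proj₂ (proj₂ dyck) (suc i) (s≤s z≤n)

  open UnitStepPath steps

  d≤h : ∀ {i} → i ≤ L → d i ≤ h
  d≤h = ≤-height L d

  m<h : m < h
  m<h = 1≤n⇒⌊n/2⌋<n h≥1

  σmax-first : IsFirst (level h) 0 L σmax
  σmax-first with height-attained L d
  ... | i , i≤L , di≡h = minIn-isFirst (level h) z≤n i≤L (≡⇒≡ᵇ _ _ di≡h)

  σmax≤L : σmax ≤ L
  σmax≤L = IsFirst.x≤hi σmax-first

  d[σmax]≡h : d σmax ≡ h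
  d[σmax]≡h = ≡ᵇ⇒≡ _ _ (IsFirst.holds σmax-first)

  m≤d[σmax] : m ≤ d σmax
  m≤d[σmax] = subst (m ≤_) (sym d[σmax]≡h) (<⇒≤ m<h)

  σg-last : IsLast (level m) 0 σmax σg
  σg-last with ivt z≤n σmax≤L (inj₁ (subst (_≤ m) (sym d[0]≡0) z≤n , m≤d[σmax]))
  ... | w , _ , w≤σmax , dw≡m = maxIn-isLast (level m) z≤n w≤σmax (≡⇒≡ᵇ _ _ dw≡m)

  visit-after-max : ∃[ w ] σmax ≤ w × w ≤ L × d w ≡ m
  visit-after-max =
    ivt σmax≤L ≤-refl (inj₂ (m≤d[σmax] , subst (_≤ m) (sym d[L]≡0) z≤n))

  σd-first : IsFirst (level m) σmax L σd
  σd-first with visit-after-max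
  ... | w , σmax≤w , w≤L , dw≡m = minIn-isFirst (level m) σmax≤w w≤L (≡⇒≡ᵇ _ _ dw≡m)

  σlast-last : IsLast (level m) σmax L σlast
  σlast-last with visit-after-max
  ... | w , σmax≤w , w≤L , dw≡m = maxIn-isLast (level m) σmax≤w w≤L (≡⇒≡ᵇ _ _ dw≡m)

  d[σg]≡m : d σg ≡ m
  d[σg]≡m = ≡ᵇ⇒≡ _ _ (IsLast.holds σg-last)

  d[σd]≡m : d σd ≡ m
  d[σd]≡m = ≡ᵇ⇒≡ _ _ (IsFirst.holds σd-first)

  σg<σmax : σg < σmax
  σg<σmax = ≤∧≢⇒< (IsLast.x≤hi σg-last) λ σg≡σmax →
    <⇒≢ m<h (trans (sym d[σg]≡m) (trans (cong d σg≡σmax) d[σmax]≡h))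

  σmax<σd : σmax < σd
  σmax<σd = ≤∧≢⇒< (IsFirst.lo≤x σd-first) λ σmax≡σd →
    <⇒≢ m<h (trans (sym d[σd]≡m) (trans (cong d (sym σmax≡σd)) d[σmax]≡h))

  σd≤σlast : σd ≤ σlast
  σd≤σlast = ≮⇒≥ λ σlast<σd →
    IsLast.fails-after σlast-last σlast<σd (IsFirst.x≤hi σd-first) (IsFirst.holds σd-first)

  σg≤σlast : σg ≤ σlast
  σg≤σlast = ≤-trans (<⇒≤ σg<σmax) (IsLast.lo≤x σlast-last)

  h∸m∸1≡⌈h/2⌉∸1 : h ∸ m ∸ 1 ≡ ⌈ h /2⌉ ∸ 1
  h∸m∸1≡⌈h/2⌉∸1 = cong (_∸ 1) (n∸⌊n/2⌋≡⌈n/2⌉ h)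

  dfix-height : height Lfix dfix ≡ ⌈ h /2⌉ ∸ 1
  dfix-height with index-of-interior σg<σmax σmax<σd
  ... | i , i≤Lfix , σg+1+i≡σmax = trans
    (height-≡ Lfix dfix bound i≤Lfix
      (cong (λ t → t ∸ m ∸ 1) (trans (cong d σg+1+i≡σmax) d[σmax]≡h)))
    h∸m∸1≡⌈h/2⌉∸1
    where
    bound : ∀ i → i ≤ Lfix → dfix i ≤ h ∸ m ∸ 1
    bound i i≤Lfix = ∸-monoˡ-≤ 1 (∸-monoˡ-≤ m (d≤h (≤-trans
      (<⇒≤ (interior-index (≤-<-trans σg<σmax σmax<σd) i≤Lfix)) (IsFirst.x≤hi σd-first))))

  dfree-left : ∀ {i} → i ≤ σg → dfree i ≡ d i
  dfree-left {i} = if-≤ᵇ-yes {i} {σg} {p = d i} {q = d (σlast + (i ∸ σg))}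

  dfree-right : ∀ {i} → σg < i → dfree i ≡ d (σlast + (i ∸ σg))
  dfree-right {i} = if-≤ᵇ-no {i} {σg} {p = d i} {q = d (σlast + (i ∸ σg))}

  dfree-lower : m ≤ height Lfree dfree
  dfree-lower =
    subst (_≤ height Lfree dfree) (trans (dfree-left ≤-refl) d[σg]≡m) (≤-height Lfree dfree σg≤Lfree)
    where
    σg≤Lfree : σg ≤ Lfree
    σg≤Lfree = m+n≤o⇒m≤o∸n σg (subst (_≤ L) (sym (m+[n∸m]≡n σg≤σlast)) (IsLast.x≤hi σlast-last))

  before-max : ∀ {i} → i < σmax → d i < h
  before-max i<σmax = ≤∧≢⇒< (d≤h (≤-trans (<⇒≤ i<σmax) σmax≤L))
    (IsFirst.fails-before σmax-first z≤n i<σmax ∘ ≡⇒≡ᵇ _ _)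

  after-last : ∀ {z} → σlast < z → z ≤ L → d z < m
  after-last {z} σlast<z z≤L = ≰⇒> λ m≤dz →
    Avoids⇒¬Between z≤L ≤-refl avoids (inj₂ (m≤dz , subst (_≤ m) (sym d[L]≡0) z≤n))
    where
    avoids : Avoids m z L
    avoids z≤w w≤L = IsLast.fails-after σlast-last (<-≤-trans σlast<z z≤w) w≤L ∘ ≡⇒≡ᵇ _ _

  dfree-upper : height Lfree dfree ≤ h ∸ 1
  dfree-upper = height-lub Lfree dfree bound
    where
    bound : ∀ i → i ≤ Lfree → dfree i ≤ h ∸ 1
    bound i i≤Lfree with i ≤? σg
    ... | yes i≤σg = subst (_≤ h ∸ 1) (sym (dfree-left i≤σg))
                       (<⇒≤∸1 (before-max (≤-<-trans i≤σg σg<σmax)))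
    ... | no i≰σg with shifted-index σg≤σlast (IsLast.x≤hi σlast-last) (≰⇒> i≰σg) i≤Lfree
    ...   | σlast<z , z≤L = subst (_≤ h ∸ 1) (sym (dfree-right (≰⇒> i≰σg)))
                              (<⇒≤∸1 (<-trans (after-last σlast<z z≤L) m<h))

  excursion-bound : ∀ {x y} → y ≤ L → Gap (level m) x y →
    2 * height (y ∸ x ∸ 2) (λ i → ∣ d (x + 1 + i) - m ∣ ∸ 1)
      + (if d x <ᵇ d (x + 1) then 1 else 2) ≤ h
  excursion-bound {x} {y} y≤L gap = by-side (excursion-side y≤L gap)
    where
    F : ℕ → ℕ
    F i = ∣ d (x + 1 + i) - m ∣ ∸ 1
    dx≡m : d x ≡ m
    dx≡m = ≡ᵇ⇒≡ _ _ (Gap.holds-x gap)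
    x<x+1 : x < x + 1
    x<x+1 = m<m+n x z<s
    interior : ∀ {i} → suc x < y → i ≤ y ∸ x ∸ 2 → x < x + 1 + i × x + 1 + i < y
    interior {i} 1+x<y i≤ = <-≤-trans x<x+1 (m≤m+n (x + 1) i) , interior-index 1+x<y i≤
    by-side : suc x < y × (StrictlyAbove m x y ⊎ StrictlyBelow m x y) →
              2 * height (y ∸ x ∸ 2) F + (if d x <ᵇ d (x + 1) then 1 else 2) ≤ h
    by-side (1+x<y , inj₁ above) = begin
      2 * height (y ∸ x ∸ 2) F + (if d x <ᵇ d (x + 1) then 1 else 2)
        ≡⟨ cong (2 * height (y ∸ x ∸ 2) F +_) (if-<ᵇ-yes d[x]<d[x+1]) ⟩
      2 * height (y ∸ x ∸ 2) F + 1
        ≤⟨ +-monoˡ-≤ 1 (*-monoʳ-≤ 2 (height-lub _ F bound)) ⟩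
      2 * (h ∸ m ∸ 1) + 1
        ≡⟨ cong (λ t → 2 * t + 1) h∸m∸1≡⌈h/2⌉∸1 ⟩
      2 * (⌈ h /2⌉ ∸ 1) + 1
        ≤⟨ 2*[⌈n/2⌉∸1]+1≤n h h≥1 ⟩
      h ∎
      where
      open ≤-Reasoning
      d[x]<d[x+1] : d x < d (x + 1)
      d[x]<d[x+1] = subst (_< d (x + 1)) (sym dx≡m) (above x<x+1 (subst (_< y) (+-comm 1 x) 1+x<y))
      bound : ∀ i → i ≤ y ∸ x ∸ 2 → F i ≤ h ∸ m ∸ 1
      bound i i≤ with interior 1+x<y i≤
      ... | x<z , z<y =
        subst (_≤ h ∸ m ∸ 1) (cong (_∸ 1) (sym (m≤n⇒∣n-m∣≡n∸m (<⇒≤ (above x<z z<y)))))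
          (∸-monoˡ-≤ 1 (∸-monoˡ-≤ m (d≤h (≤-trans (<⇒≤ z<y) y≤L))))
    by-side (1+x<y , inj₂ below) = begin
      2 * height (y ∸ x ∸ 2) F + (if d x <ᵇ d (x + 1) then 1 else 2)
        ≡⟨ cong (2 * height (y ∸ x ∸ 2) F +_) (if-<ᵇ-no (<⇒≤ d[x+1]<d[x])) ⟩
      2 * height (y ∸ x ∸ 2) F + 2
        ≤⟨ +-monoˡ-≤ 2 (*-monoʳ-≤ 2 (height-lub _ F bound)) ⟩
      2 * (m ∸ 1) + 2
        ≤⟨ 2*[⌊n/2⌋∸1]+2≤n h (≤-trans (s≤s z≤n) d[x+1]<m) ⟩
      h ∎
      where
      open ≤-Reasoning
      d[x+1]<m : d (x + 1) < m
      d[x+1]<m = below x<x+1 (subst (_< y) (+-comm 1 x) 1+x<y)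
      d[x+1]<d[x] : d (x + 1) < d x
      d[x+1]<d[x] = subst (d (x + 1) <_) (sym dx≡m) d[x+1]<m
      bound : ∀ i → i ≤ y ∸ x ∸ 2 → F i ≤ m ∸ 1
      bound i i≤ with interior 1+x<y i≤
      ... | x<z , z<y =
        subst (_≤ m ∸ 1) (cong (_∸ 1) (sym (m≤n⇒∣m-n∣≡n∸m (<⇒≤ (below x<z z<y)))))
          (∸-monoˡ-≤ 1 (m∸n≤m m (d (x + 1 + i))))

  spn-height : (j : ℕ) → 1 ≤ j → j ≤ ℓ → 2 * height (Lspn j) (dspn j) + v j ≤ h
  -- ρ is 1-indexed over the 0-indexed list rhos, so ρ (suc j) and ρ (suc (suc j)) are entries j, suc j.
  spn-height (suc j) _ j<ℓ =
    excursion-bound ρ[j+2]≤L (hitsFrom-gap (level m) (σlast ∸ σd) σd j 1+j<len)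
    where
    1+j<len : suc j < length rhos
    1+j<len = 1+m≤n∸1⇒1+m<n j<ℓ
    ρ[j+2]≤L : ρ (suc (suc j)) ≤ L
    ρ[j+2]≤L = ≤-trans (hitsFrom-≤ (level m) (σlast ∸ σd) σd (suc j) 1+j<len)
                 (≤-trans (≤-reflexive (m+[n∸m]≡n σd≤σlast)) (IsLast.x≤hi σlast-last))

lemma3p1 : (n : ℕ) (d : ℕ → ℕ) → IsDyck n d → 1 ≤ Decomp.h n d →
    ((j : ℕ) → 1 ≤ j → j ≤ Decomp.ℓ n d →
      2 * height (Decomp.Lspn n d j) (Decomp.dspn n d j) + Decomp.v n d j ≤ Decomp.h n d)
    × (height (Decomp.Lfix n d) (Decomp.dfix n d) ≡ ⌈ Decomp.h n d /2⌉ ∸ 1)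
    × (height (Decomp.Lfix n d) (Decomp.dfix n d) ≡ ⌊ (Decomp.h n d ∸ 1) /2⌋)
    × (⌊ Decomp.h n d /2⌋ ≤ height (Decomp.Lfree n d) (Decomp.dfree n d))
    × (height (Decomp.Lfree n d) (Decomp.dfree n d) ≤ Decomp.h n d ∸ 1)
lemma3p1 n d dyck h≥1 =
    spn-height
  , dfix-height
  , trans dfix-height (⌈n/2⌉∸1≡⌊[n∸1]/2⌋ h)
  , dfree-lower
  , dfree-upper
  where
  open Decomp n d using (h)
  open DyckDecomposition {n} dyck h≥1
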